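{- Let $n\geq 2$ and $\mathcal{F}\subset 2^{[n]}$. Then $\beta(\mathcal{F})\leq\frac{n}{4(n-1)}|\mathcal{F}|$.
   Context: $2^{[n]}$ is the power set of $[n]=\{1,\dots,n\}$. For distinct $i,j\in[n]$, let $b_{ij}(\mathcal{F})=|\{F\in\mathcal{F}\colon i\in F,\ j\notin F\}|$; the sturdiness is $\beta(\mathcal{F})=\min_{1\leq i\neq j\leq n} b_{ij}(\mathcal{F})$. -}

module Defs where

open import Data.Nat using (ℕ; zero; suc; _⊓_)
open import Data.Bool using (Bool; true; false; _∧_; not)
open import Data.Fin using (Fin; _≟_)
open import Data.Fin.Subset using (Subset; _∈_)
open import Data.Fin.Subset.Properties using (_∈?_)
open import Data.List using (List; []; _∷_; filter; length; allFin; concatMap; foldr; map)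
open import Data.Product using (_×_; _,_)
open import Relation.Nullary using (¬_; Dec; yes; no)
open import Relation.Nullary.Decidable using (⌊_⌋)
open import Data.Vec using (lookup)

-- A family F ⊆ 2^[n] is a duplicate-free list of subsets of Fin n
-- (distinctness imposed via Unique in the statement).

b : ∀ {n} → Fin n → Fin n → List (Subset n) → ℕ
b i j 𝓕 = length (filter (λ F → (i ∈? F) Relation.Nullary.×-dec (Relation.Nullary.¬? (j ∈? F))) 𝓕)

distinctPairs : (n : ℕ) → List (Fin n × Fin n)
distinctPairs n = concatMap (λ i → map (λ j → (i , j)) (filter (λ j → Relation.Nullary.¬? (i ≟ j)) (allFin n))) (allFin n)

-- minimum of a nonempty list (head used as seed); on [] returns 0,
-- which never occurs for n ≥ 2
minList : List ℕ → ℕ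
minList [] = 0
minList (x ∷ xs) = foldr _⊓_ x xs

β : ∀ {n} → List (Subset n) → ℕ
β {n} 𝓕 = minList (map (λ { (i , j) → b i j 𝓕 }) (distinctPairs n))

-- Double counting: summing b_ij over the n(n-1) ordered pairs counts, for each
-- F ∈ 𝓕, the pairs (i, j) with i ∈ F and j ∉ F, of which there are
-- |F| (n - |F|) ≤ n²/4.  Hence n(n-1) β(𝓕) ≤ Σ b_ij ≤ |𝓕| n²/4.
module Submission where

open import Defs
open import Data.Nat using (ℕ; suc; _+_; _*_; _∸_; _≤_; _⊓_; z≤n)
open import Data.Nat.Properties
  using (≤-refl; ≤-trans; ≤-total; ≤-reflexive; +-identityʳ; +-comm; *-comm; *-zeroʳ; *-identityʳ;
         *-distribˡ-+; +-mono-≤; +-monoʳ-≤; *-monoʳ-≤; m≤m+n; m≤n+m; m⊓n≤m; m⊓n≤n;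
         m≤n⇒∃[o]m+o≡n; *-cancelˡ-≤; module ≤-Reasoning)
open import Data.Nat.ListAction using (sum)
open import Data.Nat.ListAction.Properties using (sum-++)
open import Data.Nat.Tactic.RingSolver using (solve-∀)
open import Data.Bool using (Bool; true; false; _∧_; not)
open import Data.Fin using (Fin; _≟_) renaming (zero to fzero; suc to fsuc)
open import Data.Fin.Subset using (Subset)
open import Data.Fin.Subset.Properties using (_∈?_)
open import Data.List using (List; []; _∷_; _++_; length; map; filter; concatMap; foldr; allFin)
open import Data.List.Properties using (map-cong; map-∘; map-++; length-map; length-tabulate; map-tabulate)
open import Data.List.Relation.Unary.All using (All; []; _∷_)
import Data.List.Relation.Unary.All as All
open import Data.List.Relation.Unary.Unique.Propositional using (Unique)
open import Data.Product using (_×_; _,_; uncurry)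
open import Data.Sum using ([_,_]′)
open import Function using (_∘_; id)
open import Level using (0ℓ)
open import Relation.Nullary using (does; ¬?)
open import Relation.Unary using (Pred; Decidable)
open import Relation.Binary.PropositionalEquality
  using (_≡_; refl; sym; trans; cong; subst; subst₂; module ≡-Reasoning)

∑ : {A : Set} → List A → (A → ℕ) → ℕ
∑ xs f = sum (map f xs)

syntax ∑ xs (λ x → e) = ∑[ x ∈ xs ] e

𝟙 : Bool → ℕ
𝟙 true  = 1
𝟙 false = 0

𝟙-∧ : ∀ x y → 𝟙 (x ∧ y) ≡ 𝟙 x * 𝟙 y
𝟙-∧ true  y = sym (+-identityʳ (𝟙 y))
𝟙-∧ false y = refl

𝟙+𝟙-not : ∀ x → 𝟙 x + 𝟙 (not x) ≡ 1
𝟙+𝟙-not true  = refl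
𝟙+𝟙-not false = refl

module _ {A : Set} where

  ∑-cong : ∀ {f g : A → ℕ} → (∀ x → f x ≡ g x) → ∀ xs → ∑ xs f ≡ ∑ xs g
  ∑-cong f≗g xs = cong sum (map-cong f≗g xs)

  ∑-mono-≤ : ∀ {f g : A → ℕ} → (∀ x → f x ≤ g x) → ∀ xs → ∑ xs f ≤ ∑ xs g
  ∑-mono-≤ f≤g []       = z≤n
  ∑-mono-≤ f≤g (x ∷ xs) = +-mono-≤ (f≤g x) (∑-mono-≤ f≤g xs)

  ∑-+ : ∀ (f g : A → ℕ) xs → ∑[ x ∈ xs ] (f x + g x) ≡ ∑ xs f + ∑ xs g
  ∑-+ f g []       = refl
  ∑-+ f g (x ∷ xs) = trans (cong (f x + g x +_) (∑-+ f g xs)) (interchange (f x) (g x) _ _)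
    where
    interchange : ∀ a b c d → a + b + (c + d) ≡ a + c + (b + d)
    interchange = solve-∀

  ∑-*ˡ : ∀ c (f : A → ℕ) xs → ∑[ x ∈ xs ] (c * f x) ≡ c * ∑ xs f
  ∑-*ˡ c f []       = sym (*-zeroʳ c)
  ∑-*ˡ c f (x ∷ xs) = trans (cong (c * f x +_) (∑-*ˡ c f xs)) (sym (*-distribˡ-+ c (f x) _))

  ∑-const : ∀ c (xs : List A) → ∑[ _ ∈ xs ] c ≡ length xs * c
  ∑-const c []       = refl
  ∑-const c (x ∷ xs) = cong (c +_) (∑-const c xs)

  ∑-++ : ∀ (f : A → ℕ) xs ys → ∑ (xs ++ ys) f ≡ ∑ xs f + ∑ ys f
  ∑-++ f xs ys = trans (cong sum (map-++ f xs ys)) (sum-++ (map f xs) (map f ys))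

  ∑-filter-≤ : ∀ {P : Pred A 0ℓ} (P? : Decidable P) (f : A → ℕ) xs → ∑ (filter P? xs) f ≤ ∑ xs f
  ∑-filter-≤ P? f [] = z≤n
  ∑-filter-≤ P? f (x ∷ xs) with does (P? x)
  ... | false = ≤-trans (∑-filter-≤ P? f xs) (m≤n+m _ (f x))
  ... | true  = +-monoʳ-≤ (f x) (∑-filter-≤ P? f xs)

  length-filter≡∑𝟙 : ∀ {P : Pred A 0ℓ} (P? : Decidable P) xs →
                     length (filter P? xs) ≡ ∑[ x ∈ xs ] 𝟙 (does (P? x))
  length-filter≡∑𝟙 P? [] = refl
  length-filter≡∑𝟙 P? (x ∷ xs) with does (P? x)
  ... | false = length-filter≡∑𝟙 P? xs
  ... | true  = cong suc (length-filter≡∑𝟙 P? xs)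

module _ {A B : Set} where

  ∑-map : ∀ (g : A → B) (f : B → ℕ) xs → ∑ (map g xs) f ≡ ∑ xs (f ∘ g)
  ∑-map g f xs = cong sum (sym (map-∘ xs))

  ∑-concatMap : ∀ (g : A → List B) (f : B → ℕ) xs → ∑ (concatMap g xs) f ≡ ∑[ x ∈ xs ] ∑ (g x) f
  ∑-concatMap g f []       = refl
  ∑-concatMap g f (x ∷ xs) =
    trans (∑-++ f (g x) (concatMap g xs)) (cong (∑ (g x) f +_) (∑-concatMap g f xs))

  ∑-comm : ∀ (f : A → B → ℕ) xs ys → ∑[ x ∈ xs ] ∑[ y ∈ ys ] f x y ≡ ∑[ y ∈ ys ] ∑[ x ∈ xs ] f x y
  ∑-comm f []       ys = sym (trans (∑-const 0 ys) (*-zeroʳ (length ys)))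
  ∑-comm f (x ∷ xs) ys = trans (cong (∑ ys (f x) +_) (∑-comm f xs ys))
                               (sym (∑-+ (f x) (λ y → ∑[ x ∈ xs ] f x y) ys))

∑-allFin-suc : ∀ n (f : Fin (suc n) → ℕ) → ∑ (allFin (suc n)) f ≡ f fzero + ∑ (allFin n) (f ∘ fsuc)
∑-allFin-suc n f =
  cong (λ xs → f fzero + sum xs) (trans (map-tabulate fsuc f) (sym (map-tabulate id (f ∘ fsuc))))

length-allFin : ∀ n → length (allFin n) ≡ n
length-allFin n = length-tabulate {n = n} id

length≡∑1 : ∀ {A : Set} (xs : List A) → length xs ≡ ∑[ _ ∈ xs ] 1
length≡∑1 xs = sym (trans (∑-const 1 xs) (*-identityʳ (length xs)))

foldr⊓-≤ : ∀ x ys → All (foldr _⊓_ x ys ≤_) (x ∷ ys)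
foldr⊓-≤ x []       = ≤-refl ∷ []
foldr⊓-≤ x (y ∷ ys) with foldr⊓-≤ x ys
... | x≥m ∷ ys≥m = ≤-trans (m⊓n≤n y _) x≥m ∷ m⊓n≤m y _ ∷ All.map (≤-trans (m⊓n≤n y _)) ys≥m

minList-≤ : ∀ xs → All (minList xs ≤_) xs
minList-≤ []       = []
minList-≤ (x ∷ xs) = foldr⊓-≤ x xs

length*lowerBound≤sum : ∀ {m} xs → All (m ≤_) xs → length xs * m ≤ sum xs
length*lowerBound≤sum []       []           = z≤n
length*lowerBound≤sum (x ∷ xs) (m≤x ∷ m≤xs) = +-mono-≤ m≤x (length*lowerBound≤sum xs m≤xs)

length*minList≤sum : ∀ xs → length xs * minList xs ≤ sum xs
length*minList≤sum xs = length*lowerBound≤sum xs (minList-≤ xs)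

count-≢ : ∀ {n} (i : Fin n) → suc (∑[ j ∈ allFin n ] 𝟙 (not (does (i ≟ j)))) ≡ n
count-≢ {suc n} fzero    = cong suc (begin
  ∑[ j ∈ allFin (suc n) ] 𝟙 (not (does (fzero ≟ j))) ≡⟨ ∑-allFin-suc n (λ j → 𝟙 (not (does (fzero ≟ j)))) ⟩
  ∑[ _ ∈ allFin n ] 1                                   ≡⟨ length≡∑1 (allFin n) ⟨
  length (allFin n)                                     ≡⟨ length-allFin n ⟩
  n                                                     ∎)
  where open ≡-Reasoning
count-≢ {suc n} (fsuc i) = cong suc (trans (∑-allFin-suc n (λ j → 𝟙 (not (does (fsuc i ≟ j))))) (count-≢ i))

distinctFrom : ∀ {n} → Fin n → List (Fin n)
distinctFrom {n} i = filter (λ j → ¬? (i ≟ j)) (allFin n)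

length-distinctFrom : ∀ {n} (i : Fin n) → length (distinctFrom i) ≡ n ∸ 1
length-distinctFrom {n} i =
  trans (length-filter≡∑𝟙 (λ j → ¬? (i ≟ j)) (allFin n)) (cong (_∸ 1) (count-≢ i))

∑-distinctPairs : ∀ n (f : Fin n × Fin n → ℕ) →
  ∑ (distinctPairs n) f ≡ ∑[ i ∈ allFin n ] ∑[ j ∈ distinctFrom i ] f (i , j)
∑-distinctPairs n f = trans (∑-concatMap (λ i → map (i ,_) (distinctFrom i)) f (allFin n))
                            (∑-cong (λ i → ∑-map (i ,_) f (distinctFrom i)) (allFin n))

∑-distinctPairs-≤ : ∀ n (f : Fin n × Fin n → ℕ) →
  ∑ (distinctPairs n) f ≤ ∑[ i ∈ allFin n ] ∑[ j ∈ allFin n ] f (i , j)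
∑-distinctPairs-≤ n f = ≤-trans (≤-reflexive (∑-distinctPairs n f))
  (∑-mono-≤ (λ i → ∑-filter-≤ (λ j → ¬? (i ≟ j)) (λ j → f (i , j)) (allFin n)) (allFin n))

length-distinctPairs : ∀ n → length (distinctPairs n) ≡ n * (n ∸ 1)
length-distinctPairs n = begin
  length (distinctPairs n)
    ≡⟨ length≡∑1 (distinctPairs n) ⟩
  ∑[ _ ∈ distinctPairs n ] 1
    ≡⟨ ∑-distinctPairs n (λ _ → 1) ⟩
  ∑[ i ∈ allFin n ] ∑[ _ ∈ distinctFrom i ] 1
    ≡⟨ ∑-cong (λ i → trans (sym (length≡∑1 (distinctFrom i))) (length-distinctFrom i)) (allFin n) ⟩
  ∑[ _ ∈ allFin n ] (n ∸ 1)
    ≡⟨ ∑-const (n ∸ 1) (allFin n) ⟩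
  length (allFin n) * (n ∸ 1)
    ≡⟨ cong (_* (n ∸ 1)) (length-allFin n) ⟩
  n * (n ∸ 1) ∎
  where open ≡-Reasoning

4xy≤[x+y]² : ∀ x y → 4 * (x * y) ≤ (x + y) * (x + y)
4xy≤[x+y]² x y = [ ordered , swapped ]′ (≤-total x y)
  where
  square-expansion : ∀ x d → 4 * (x * (x + d)) + d * d ≡ (x + (x + d)) * (x + (x + d))
  square-expansion = solve-∀

  ordered : ∀ {x y} → x ≤ y → 4 * (x * y) ≤ (x + y) * (x + y)
  ordered {x} x≤y with d , refl ← m≤n⇒∃[o]m+o≡n x≤y =
    ≤-trans (m≤m+n _ (d * d)) (≤-reflexive (square-expansion x d))

  swapped : y ≤ x → 4 * (x * y) ≤ (x + y) * (x + y)
  swapped y≤x = subst₂ _≤_ (cong (4 *_) (*-comm y x)) (cong (λ s → s * s) (+-comm y x)) (ordered y≤x)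

module _ {n : ℕ} where

  _∈ᵇ_ : Fin n → Subset n → Bool
  i ∈ᵇ F = does (i ∈? F)

  separates : Subset n → Fin n × Fin n → Bool
  separates F (i , j) = i ∈ᵇ F ∧ not (j ∈ᵇ F)

  b≡∑separates : ∀ i j 𝓕 → b i j 𝓕 ≡ ∑[ F ∈ 𝓕 ] 𝟙 (separates F (i , j))
  b≡∑separates i j 𝓕 = length-filter≡∑𝟙 _ 𝓕

  ∣_∣ᵢₙ ∣_∣ₒᵤₜ : Subset n → ℕ
  ∣ F ∣ᵢₙ  = ∑[ i ∈ allFin n ] 𝟙 (i ∈ᵇ F)
  ∣ F ∣ₒᵤₜ = ∑[ j ∈ allFin n ] 𝟙 (not (j ∈ᵇ F))

  ∣F∣ᵢₙ+∣F∣ₒᵤₜ≡n : ∀ F → ∣ F ∣ᵢₙ + ∣ F ∣ₒᵤₜ ≡ n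
  ∣F∣ᵢₙ+∣F∣ₒᵤₜ≡n F = begin
    ∣ F ∣ᵢₙ + ∣ F ∣ₒᵤₜ                               ≡⟨ ∑-+ (λ i → 𝟙 (i ∈ᵇ F)) (λ i → 𝟙 (not (i ∈ᵇ F))) (allFin n) ⟨
    ∑[ i ∈ allFin n ] (𝟙 (i ∈ᵇ F) + 𝟙 (not (i ∈ᵇ F))) ≡⟨ ∑-cong (λ i → 𝟙+𝟙-not (i ∈ᵇ F)) (allFin n) ⟩
    ∑[ _ ∈ allFin n ] 1                               ≡⟨ length≡∑1 (allFin n) ⟨
    length (allFin n)                                 ≡⟨ length-allFin n ⟩
    n                                                 ∎
    where open ≡-Reasoning

  ∑∑separates≡∣F∣ₒᵤₜ*∣F∣ᵢₙ : ∀ F →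
    ∑[ i ∈ allFin n ] ∑[ j ∈ allFin n ] 𝟙 (separates F (i , j)) ≡ ∣ F ∣ₒᵤₜ * ∣ F ∣ᵢₙ
  ∑∑separates≡∣F∣ₒᵤₜ*∣F∣ᵢₙ F = begin
    ∑[ i ∈ allFin n ] ∑[ j ∈ allFin n ] 𝟙 (i ∈ᵇ F ∧ not (j ∈ᵇ F))
      ≡⟨ ∑-cong (λ i → ∑-cong (λ j → 𝟙-∧ (i ∈ᵇ F) (not (j ∈ᵇ F))) (allFin n)) (allFin n) ⟩
    ∑[ i ∈ allFin n ] ∑[ j ∈ allFin n ] (𝟙 (i ∈ᵇ F) * 𝟙 (not (j ∈ᵇ F)))
      ≡⟨ ∑-cong (λ i → ∑-*ˡ (𝟙 (i ∈ᵇ F)) (λ j → 𝟙 (not (j ∈ᵇ F))) (allFin n)) (allFin n) ⟩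
    ∑[ i ∈ allFin n ] (𝟙 (i ∈ᵇ F) * ∣ F ∣ₒᵤₜ)
      ≡⟨ ∑-cong (λ i → *-comm (𝟙 (i ∈ᵇ F)) ∣ F ∣ₒᵤₜ) (allFin n) ⟩
    ∑[ i ∈ allFin n ] (∣ F ∣ₒᵤₜ * 𝟙 (i ∈ᵇ F))
      ≡⟨ ∑-*ˡ ∣ F ∣ₒᵤₜ (λ i → 𝟙 (i ∈ᵇ F)) (allFin n) ⟩
    ∣ F ∣ₒᵤₜ * ∣ F ∣ᵢₙ ∎
    where open ≡-Reasoning

  4∑separates≤n² : ∀ F → 4 * ∑[ p ∈ distinctPairs n ] 𝟙 (separates F p) ≤ n * n
  4∑separates≤n² F = begin
    4 * ∑[ p ∈ distinctPairs n ] 𝟙 (separates F p)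
      ≤⟨ *-monoʳ-≤ 4 (∑-distinctPairs-≤ n (𝟙 ∘ separates F)) ⟩
    4 * ∑[ i ∈ allFin n ] ∑[ j ∈ allFin n ] 𝟙 (separates F (i , j))
      ≡⟨ cong (4 *_) (∑∑separates≡∣F∣ₒᵤₜ*∣F∣ᵢₙ F) ⟩
    4 * (∣ F ∣ₒᵤₜ * ∣ F ∣ᵢₙ)
      ≤⟨ 4xy≤[x+y]² ∣ F ∣ₒᵤₜ ∣ F ∣ᵢₙ ⟩
    (∣ F ∣ₒᵤₜ + ∣ F ∣ᵢₙ) * (∣ F ∣ₒᵤₜ + ∣ F ∣ᵢₙ)
      ≡⟨ cong (λ s → s * s) (trans (+-comm ∣ F ∣ₒᵤₜ ∣ F ∣ᵢₙ) (∣F∣ᵢₙ+∣F∣ₒᵤₜ≡n F)) ⟩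
    n * n ∎
    where open ≤-Reasoning

∑b : ∀ {n} → List (Subset n) → ℕ
∑b {n} 𝓕 = ∑[ p ∈ distinctPairs n ] uncurry (λ i j → b i j 𝓕) p

n[n∸1]β≤∑b : ∀ {n} (𝓕 : List (Subset n)) → n * (n ∸ 1) * β 𝓕 ≤ ∑b 𝓕
n[n∸1]β≤∑b {n} 𝓕 = subst (λ m → m * β 𝓕 ≤ ∑b 𝓕) length-bs (length*minList≤sum bs)
  where
  bs : List ℕ
  bs = map (uncurry (λ i j → b i j 𝓕)) (distinctPairs n)

  length-bs : length bs ≡ n * (n ∸ 1)
  length-bs = trans (length-map _ (distinctPairs n)) (length-distinctPairs n)

4∑b≤∣𝓕∣n² : ∀ {n} (𝓕 : List (Subset n)) → 4 * ∑b 𝓕 ≤ length 𝓕 * (n * n)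
4∑b≤∣𝓕∣n² {n} 𝓕 = begin
  4 * ∑b 𝓕
    ≡⟨ cong (4 *_) (∑-cong (λ (i , j) → b≡∑separates i j 𝓕) (distinctPairs n)) ⟩
  4 * ∑[ p ∈ distinctPairs n ] ∑[ F ∈ 𝓕 ] 𝟙 (separates F p)
    ≡⟨ cong (4 *_) (∑-comm (λ p F → 𝟙 (separates F p)) (distinctPairs n) 𝓕) ⟩
  4 * ∑[ F ∈ 𝓕 ] ∑[ p ∈ distinctPairs n ] 𝟙 (separates F p)
    ≡⟨ ∑-*ˡ 4 (λ F → ∑[ p ∈ distinctPairs n ] 𝟙 (separates F p)) 𝓕 ⟨
  ∑[ F ∈ 𝓕 ] (4 * ∑[ p ∈ distinctPairs n ] 𝟙 (separates F p))
    ≤⟨ ∑-mono-≤ 4∑separates≤n² 𝓕 ⟩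
  ∑[ _ ∈ 𝓕 ] (n * n)
    ≡⟨ ∑-const (n * n) 𝓕 ⟩
  length 𝓕 * (n * n) ∎
  where open ≤-Reasoning

fact5p1 : (n : ℕ) → 2 ≤ n → (𝓕 : List (Subset n)) → Unique 𝓕 →
    4 * (n ∸ 1) * β 𝓕 ≤ n * length 𝓕
fact5p1 n@(suc _) _ 𝓕 _ = *-cancelˡ-≤ n (begin
  n * (4 * (n ∸ 1) * β 𝓕) ≡⟨ regroup n (n ∸ 1) (β 𝓕) ⟩
  4 * (n * (n ∸ 1) * β 𝓕) ≤⟨ *-monoʳ-≤ 4 (n[n∸1]β≤∑b 𝓕) ⟩
  4 * ∑b 𝓕                ≤⟨ 4∑b≤∣𝓕∣n² 𝓕 ⟩
  length 𝓕 * (n * n)      ≡⟨ regroup′ n (length 𝓕) ⟩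
  n * (n * length 𝓕)      ∎)
  where
  open ≤-Reasoning
  regroup : ∀ n m x → n * (4 * m * x) ≡ 4 * (n * m * x)
  regroup = solve-∀
  regroup′ : ∀ n N → N * (n * n) ≡ n * (n * N)
  regroup′ = solve-∀
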